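{- Let $G$ be a finite, simple, connected, undirected graph. Every maximal independent set of $G$ is robust if and only if $G$ is a complete bipartite graph or a sputnik.
   Context: A connected spanning subgraph of $G=(V,E_G)$ is a connected graph $H=(V,E_H)$ with $E_H\subseteq E_G$. A maximal independent set (MIS) of $G$ is a set of pairwise non-adjacent vertices that is maximal for inclusion among such sets. An MIS $S$ of $G$ is robust if $S$ is a maximal independent set in every connected spanning subgraph of $G$ (including $G$ itself). A vertex is pendant if it has degree $1$. A graph is a sputnik if every vertex that belongs to a cycle has at least one pendant neighbor. A complete bipartite graph is a graph whose vertex set is partitioned into two disjoint sets $V_1,V_2$ such that the edge set is exactly $\{\{v_1,v_2\}: v_1\in V_1, v_2\in V_2\}$. -}

module Defs where

open import Data.Nat using (ℕ; zero; suc; _+_; _≤_)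
open import Data.Bool using (Bool; true; false; if_then_else_)
open import Data.Fin using (Fin)
open import Data.List using (List; []; _∷_; length; foldr; allFin; head)
open import Data.List.Relation.Unary.Unique.Propositional using (Unique)
open import Data.List.Membership.Propositional using (_∈_)
open import Data.Empty using (⊥)
open import Data.Product using (Σ; ∃; _×_; _,_)
open import Relation.Binary.PropositionalEquality using (_≡_; _≢_)
open import Relation.Nullary using (¬_)
open import Function.Bundles using (_⇔_)
import Data.Fin.Subset as Sub

record Graph (n : ℕ) : Set where
  field
    adj   : Fin n → Fin n → Bool
    sym   : ∀ u v → adj u v ≡ adj v u
    irref : ∀ v → adj v v ≡ false

open Graph public

Adj : ∀ {n} → Graph n → Fin n → Fin n → Set
Adj G u v = adj G u v ≡ true

data Reach {n} (G : Graph n) : Fin n → Fin n → Set where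
  here : ∀ {v} → Reach G v v
  step : ∀ {u v w} → Adj G u v → Reach G v w → Reach G u w

Connected : ∀ {n} → Graph n → Set
Connected {n} G = ∀ (u v : Fin n) → Reach G u v

SpanningSubgraph : ∀ {n} → Graph n → Graph n → Set
SpanningSubgraph {n} H G = ∀ (u v : Fin n) → Adj H u v → Adj G u v

Independent : ∀ {n} → Graph n → Sub.Subset n → Set
Independent G S = ∀ u v → u Sub.∈ S → v Sub.∈ S → ¬ Adj G u v

IsMIS : ∀ {n} → Graph n → Sub.Subset n → Set
IsMIS G S = Independent G S × (∀ T → Independent G T → S Sub.⊆ T → T Sub.⊆ S)

Robust : ∀ {n} → Graph n → Sub.Subset n → Set
Robust {n} G S = ∀ (H : Graph n) → SpanningSubgraph H G → Connected H → IsMIS H S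

degree : ∀ {n} → Graph n → Fin n → ℕ
degree {n} G v = foldr (λ u k → if adj G v u then suc k else k) 0 (allFin n)

Pendant : ∀ {n} → Graph n → Fin n → Set
Pendant G v = degree G v ≡ 1

data Path {n} (G : Graph n) : List (Fin n) → Set where
  single : ∀ v → Path G (v ∷ [])
  cons   : ∀ u v vs → Adj G u v → Path G (v ∷ vs) → Path G (u ∷ v ∷ vs)

last : ∀ {A : Set} → A → List A → A
last a [] = a
last a (b ∷ bs) = last b bs

IsCycle : ∀ {n} → Graph n → List (Fin n) → Set
IsCycle G [] = ⊥
IsCycle G (v ∷ vs) =
  (3 ≤ length (v ∷ vs)) × Unique (v ∷ vs) × Path G (v ∷ vs) × Adj G (last v vs) v

OnCycle : ∀ {n} → Graph n → Fin n → Set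
OnCycle {n} G v = Σ (List (Fin n)) λ c → IsCycle G c × v ∈ c

Sputnik : ∀ {n} → Graph n → Set
Sputnik {n} G = ∀ (v : Fin n) → OnCycle G v → Σ (Fin n) λ u → Adj G v u × Pendant G u

CompleteBipartite : ∀ {n} → Graph n → Set
CompleteBipartite {n} G =
  Σ (Fin n → Bool) λ side → ∀ u v → (Adj G u v ⇔ (side u ≢ side v))

module Submission where

-- Sufficiency: an MIS S of G stops being maximal in a connected spanning subgraph H only at some
-- y ∉ S all of whose edges into S were removed. In a complete bipartite graph every neighbour of
-- such a y lies in S, and H has to keep at least one edge at y. In a sputnik the H-walk from y to a
-- removed S-neighbour closes a cycle through y, so y has a pendant neighbour; it lies in S and its
-- only edge survives in H.
--
-- Necessity: let all MISs be robust and let v be a vertex none of whose neighbours is a leaf. Two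
-- neighbours p, q of v joined in G ∖ v have the same neighbourhood: otherwise some c ~ q has c ≁ p,
-- and an MIS S containing p, c and a neighbour of one neighbour of v in each other component of
-- G ∖ v loses its maximality at v once the edges from v into S are removed, although the graph
-- stays connected. If x lies on a cycle and has no pendant neighbour, this applies at x and at its
-- cycle-neighbour a: every neighbour of a is then a twin of x and every neighbour of x a twin of a,
-- so G is complete bipartite with parts N(a) and N(x).

open import Defs
open import Data.Bool using (Bool; true; false; not; _∧_; if_then_else_)
open import Data.Bool.Properties using (∧-conicalˡ; ¬-not) renaming (_≟_ to _≟ᵇ_)
open import Data.Empty using (⊥; ⊥-elim)
open import Data.Fin using (Fin; zero; suc; _<_)
open import Data.Fin.Properties using (_≟_; any?; all?; <-cmp; _<?_)
open import Data.Fin.Subset using (Subset; _∈_; _∉_; _⊆_; ⁅_⁆; _∪_)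
open import Data.Fin.Subset.Properties
  using (_∈?_; x∈⁅x⁆; x∈⁅y⁆⇒x≡y; x∈p∪q⁻; x∈p∪q⁺; q⊆p∪q)
open import Data.List using (List; []; _∷_; _++_; _∷ʳ_; length; foldr; filter; allFin)
open import Data.List.Properties using (++-assoc)
open import Data.List.Membership.Propositional using () renaming (_∈_ to _∈ₗ_)
open import Data.List.Membership.Propositional.Properties using (∈-allFin; ∈-filter⁺; ∈-filter⁻; ∈-∃++)
import Data.List.Membership.DecPropositional as DecMembership
open import Data.List.Relation.Unary.All as All using (All; []; _∷_)
open import Data.List.Relation.Unary.All.Properties using (¬Any⇒All¬)
open import Data.List.Relation.Unary.Any using (here; there)
open import Data.List.Relation.Unary.AllPairs using ([]; _∷_)
open import Data.List.Relation.Unary.Unique.Propositional using (Unique)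
open import Data.List.Relation.Unary.Unique.Propositional.Properties using (++⁺; filter⁺; allFin⁺)
open import Data.Nat as ℕ using (ℕ; _≤_; s≤s)
open import Data.Product as Product using (∃; ∃₂; _×_; _,_; proj₁; proj₂)
open import Data.Sum as Sum using (_⊎_; inj₁; inj₂; [_,_])
open import Data.Vec using (tabulate)
open import Data.Vec.Properties using ([]=⇒lookup; lookup⇒[]=; lookup∘tabulate)
open import Function using (_∘_; id)
open import Function.Bundles using (_⇔_; mk⇔; module Equivalence)
open import Relation.Binary using (DecidableEquality; tri<; tri≈; tri>)
import Relation.Binary.PropositionalEquality as ≡
open ≡ using (_≡_; _≢_; refl; cong; subst; ≢-sym)
open import Relation.Nullary using (¬_; Dec; yes; no; does; ¬?)
open import Relation.Nullary.Decidable
  using (_×-dec_; _⊎-dec_; _→-dec_; dec-true; dec-false; does-⇔; decidable-stable; ¬¬-excluded-middle)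

¬¬-shift-Fin : ∀ {n} {P : Fin n → Set} → (∀ i → ¬ ¬ P i) → ¬ ¬ (∀ i → P i)
¬¬-shift-Fin {ℕ.zero} _ k = k λ ()
¬¬-shift-Fin {ℕ.suc n} h k =
  h zero λ p₀ → ¬¬-shift-Fin (h ∘ suc) λ ps → k λ { zero → p₀ ; (suc i) → ps i }

¬¬-decidable₂ : ∀ {n} {R : Fin n → Fin n → Set} → ¬ ¬ (∀ u w → Dec (R u w))
¬¬-decidable₂ = ¬¬-shift-Fin λ _ → ¬¬-shift-Fin λ _ → ¬¬-excluded-middle

minimal : ∀ {n} {P : Fin n → Set} → (∀ i → Dec (P i)) → ∀ {i} → P i →
          ∃ λ j → P j × (∀ k → k < j → ¬ P k)
minimal P? {zero} p₀ = zero , p₀ , λ _ ()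
minimal P? {suc i} pᵢ with P? zero
... | yes p₀ = zero , p₀ , λ _ ()
... | no ¬p₀ with minimal (P? ∘ suc) pᵢ
...   | j , pⱼ , below = suc j , pⱼ , λ { zero _ → ¬p₀ ; (suc k) (s≤s k<j) → below k k<j }

_⇔?_ : ∀ {A B : Set} → Dec A → Dec B → Dec (A ⇔ B)
yes a ⇔? yes b = yes (mk⇔ (λ _ → b) (λ _ → a))
yes a ⇔? no ¬b = no λ a⇔b → ¬b (Equivalence.to a⇔b a)
no ¬a ⇔? yes b = no λ a⇔b → ¬a (Equivalence.from a⇔b b)
no ¬a ⇔? no ¬b = yes (mk⇔ (⊥-elim ∘ ¬a) (⊥-elim ∘ ¬b))

module _ {n} {P : Fin n → Set} (P? : ∀ x → Dec (P x)) where

  subset : Subset n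
  subset = tabulate (does ∘ P?)

  ∈-subset⁺ : ∀ {x} → P x → x ∈ subset
  ∈-subset⁺ {x} px = lookup⇒[]= x subset (≡.trans (lookup∘tabulate _ x) (dec-true (P? x) px))

  ∈-subset⁻ : ∀ {x} → x ∈ subset → P x
  ∈-subset⁻ {x} x∈ with P? x | ≡.trans (≡.sym (lookup∘tabulate (does ∘ P?) x)) ([]=⇒lookup x∈)
  ... | yes px | _  = px
  ... | no _   | ()

module _ {A : Set} where

  count-if≡length-filter : ∀ (f : A → Bool) xs →
    foldr (λ u k → if f u then ℕ.suc k else k) 0 xs ≡ length (filter (λ u → f u ≟ᵇ true) xs)
  count-if≡length-filter f [] = refl
  count-if≡length-filter f (x ∷ xs) with f x
  ... | true  = cong ℕ.suc (count-if≡length-filter f xs)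
  ... | false = count-if≡length-filter f xs

  length≡1⇒≡ : ∀ {xs : List A} {a b} → length xs ≡ 1 → a ∈ₗ xs → b ∈ₗ xs → a ≡ b
  length≡1⇒≡ {_ ∷ []} _ (here refl) (here refl) = refl

  other-member : DecidableEquality A → ∀ {xs : List A} {a} →
                 Unique xs → a ∈ₗ xs → length xs ≢ 1 → ∃ λ z → z ∈ₗ xs × z ≢ a
  other-member _ {_ ∷ []} _ _ len≢1 = ⊥-elim (len≢1 refl)
  other-member _≟ᴬ_ {x ∷ y ∷ _} {a} ((x≢y ∷ _) ∷ _) _ _ with x ≟ᴬ a
  ... | no x≢a   = x , here refl , x≢a
  ... | yes refl = y , there (here refl) , ≢-sym x≢y

  last-∷ʳ : ∀ (u : A) xs w → last u (xs ∷ʳ w) ≡ w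
  last-∷ʳ u []       w = refl
  last-∷ʳ u (x ∷ xs) w = last-∷ʳ x xs w

  last-∈ : ∀ (u : A) xs → last u xs ∈ₗ u ∷ xs
  last-∈ u []       = here refl
  last-∈ u (x ∷ xs) = there (last-∈ x xs)

  length-∷ʳ : ∀ xs (w : A) → length (xs ∷ʳ w) ≡ ℕ.suc (length xs)
  length-∷ʳ []       w = refl
  length-∷ʳ (x ∷ xs) w = cong ℕ.suc (length-∷ʳ xs w)

module _ {n} (G : Graph n) where

  Adj-sym : ∀ {u w} → Adj G u w → Adj G w u
  Adj-sym {u} {w} uw = ≡.trans (sym G w u) uw

  Adj-irrefl : ∀ {v} → ¬ Adj G v v
  Adj-irrefl {v} vv with () ← ≡.trans (≡.sym vv) (irref G v)

  Adj⇒≢ : ∀ {u w} → Adj G u w → u ≢ w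
  Adj⇒≢ uw refl = Adj-irrefl uw

  Adj? : ∀ u w → Dec (Adj G u w)
  Adj? u w = adj G u w ≟ᵇ true

  reach-trans : ∀ {u v w} → Reach G u v → Reach G v w → Reach G u w
  reach-trans here       r′ = r′
  reach-trans (step e r) r′ = step e (reach-trans r r′)

  reach-sym : ∀ {u w} → Reach G u w → Reach G w u
  reach-sym here       = here
  reach-sym (step e r) = reach-trans (reach-sym r) (step (Adj-sym e) here)

  reach⇒neighbour : ∀ {u w} → u ≢ w → Reach G u w → ∃ (Adj G u)
  reach⇒neighbour u≢u here               = ⊥-elim (u≢u refl)
  reach⇒neighbour _   (step {v = v} uv _) = v , uv

module _ {n} {H G : Graph n} (H⊆G : SpanningSubgraph H G) where

  reach-mono : ∀ {u w} → Reach H u w → Reach G u w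
  reach-mono here        = here
  reach-mono (step uv r) = step (H⊆G _ _ uv) (reach-mono r)

  path-mono : ∀ {l} → Path H l → Path G l
  path-mono (single v)        = single v
  path-mono (cons u v l uv p) = cons u v l (H⊆G u v uv) (path-mono p)

  independent-mono : ∀ {S} → Independent G S → Independent H S
  independent-mono ind u w u∈S w∈S uw = ind u w u∈S w∈S (H⊆G u w uw)

module RemoveEdges {n} (G : Graph n) {Cut : Fin n → Fin n → Set}
                   (Cut? : ∀ u w → Dec (Cut u w)) (Cut-sym : ∀ {u w} → Cut u w → Cut w u) where

  graph : Graph n
  graph = record
    { adj   = λ u w → adj G u w ∧ not (does (Cut? u w))
    ; sym   = λ u w → ≡.cong₂ (λ e c → e ∧ not c) (sym G u w)
                                (does-⇔ (mk⇔ Cut-sym Cut-sym) (Cut? u w) (Cut? w u))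
    ; irref = λ v → cong (_∧ not (does (Cut? v v))) (irref G v)
    }

  ⊆-original : SpanningSubgraph graph G
  ⊆-original u w = ∧-conicalˡ _ _

  keeps : ∀ {u w} → Adj G u w → ¬ Cut u w → Adj graph u w
  keeps {u} {w} uw ¬cut rewrite uw | dec-false (Cut? u w) ¬cut = refl

  drops : ∀ {u w} → Cut u w → ¬ Adj graph u w
  drops {u} {w} cut rewrite dec-true (Cut? u w) cut with adj G u w
  ... | true  = λ ()
  ... | false = λ ()

incident? : ∀ {n} (x u w : Fin n) → Dec (u ≡ x ⊎ w ≡ x)
incident? x u w = (u ≟ x) ⊎-dec (w ≟ x)

_∖_ : ∀ {n} → Graph n → Fin n → Graph n
G ∖ x = RemoveEdges.graph G (incident? x) Sum.swap

module _ {n} (G : Graph n) (x : Fin n) where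
  private
    module G∖x = RemoveEdges G (incident? x) Sum.swap

  ∖-⊆ : SpanningSubgraph (G ∖ x) G
  ∖-⊆ = G∖x.⊆-original

  Adj-∖⁺ : ∀ {u w} → Adj G u w → u ≢ x → w ≢ x → Adj (G ∖ x) u w
  Adj-∖⁺ uw u≢x w≢x = G∖x.keeps uw [ u≢x , w≢x ]

  edge-∖ : ∀ {u w} → Adj G u w → u ≢ x → w ≢ x → Reach (G ∖ x) u w
  edge-∖ uw u≢x w≢x = step (Adj-∖⁺ uw u≢x w≢x) here

  Adj-∖⁻ : ∀ {u w} → Adj (G ∖ x) u w → u ≢ x × w ≢ x
  Adj-∖⁻ uw = (λ u≡x → G∖x.drops (inj₁ u≡x) uw) , (λ w≡x → G∖x.drops (inj₂ w≡x) uw)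

-- Maximal independent sets

module _ {n} (G : Graph n) where

  Dominates : Subset n → Fin n → Set
  Dominates S y = y ∈ S ⊎ ∃ λ s → s ∈ S × Adj G y s

  dominates-mono : ∀ {S T y} → S ⊆ T → Dominates S y → Dominates T y
  dominates-mono S⊆T = Sum.map S⊆T (Product.map₂ (Product.map₁ S⊆T))

  neighbour-in? : ∀ S y → Dec (∃ λ s → s ∈ S × Adj G y s)
  neighbour-in? S y = any? λ s → (s ∈? S) ×-dec Adj? G y s

  insert-independent : ∀ {S y} → Independent G S → ¬ (∃ λ s → s ∈ S × Adj G y s) →
                       Independent G (⁅ y ⁆ ∪ S)
  insert-independent {S} {y} ind ¬nb u w u∈ w∈ uw
    with x∈p∪q⁻ ⁅ y ⁆ S u∈ | x∈p∪q⁻ ⁅ y ⁆ S w∈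
  ... | inj₁ u∈y | inj₁ w∈y =
    Adj⇒≢ G uw (≡.trans (x∈⁅y⁆⇒x≡y y u∈y) (≡.sym (x∈⁅y⁆⇒x≡y y w∈y)))
  ... | inj₁ u∈y | inj₂ w∈S with refl ← x∈⁅y⁆⇒x≡y y u∈y = ¬nb (w , w∈S , uw)
  ... | inj₂ u∈S | inj₁ w∈y with refl ← x∈⁅y⁆⇒x≡y y w∈y = ¬nb (u , u∈S , Adj-sym G uw)
  ... | inj₂ u∈S | inj₂ w∈S = ind u w u∈S w∈S uw

  IsMIS⇔independent×dominating : ∀ {S} → IsMIS G S ⇔ (Independent G S × (∀ y → Dominates S y))
  IsMIS⇔independent×dominating {S} = mk⇔ to from
    where
    to : IsMIS G S → Independent G S × (∀ y → Dominates S y)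
    to (ind , maximal) = ind , dominates
      where
      dominates : ∀ y → Dominates S y
      dominates y with neighbour-in? S y
      ... | yes nb  = inj₂ nb
      ... | no ¬nb = inj₁ (maximal _ (insert-independent ind ¬nb) (q⊆p∪q ⁅ y ⁆ S)
                                   (x∈p∪q⁺ (inj₁ (x∈⁅x⁆ y))))
    from : Independent G S × (∀ y → Dominates S y) → IsMIS G S
    from (ind , dom) = ind , λ T indT S⊆T {x} x∈T →
      [ id , (λ { (s , s∈S , xs) → ⊥-elim (indT x s x∈T (S⊆T s∈S) xs) }) ] (dom x)

  MIS-neighbour : ∀ {S y} → IsMIS G S → y ∉ S → ∃ λ s → s ∈ S × Adj G y s
  MIS-neighbour {y = y} mis y∉S =
    [ ⊥-elim ∘ y∉S , id ] (proj₂ (Equivalence.to IsMIS⇔independent×dominating mis) y)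

  extend-dominating : ∀ ks {S} → Independent G S →
                      ∃ λ T → Independent G T × S ⊆ T × All (Dominates T) ks
  extend-dominating []       ind = _ , ind , id , []
  extend-dominating (k ∷ ks) ind with extend-dominating ks ind
  ... | T , indT , S⊆T , dom with neighbour-in? T k
  ...   | yes nb  = T , indT , S⊆T , inj₂ nb ∷ dom
  ...   | no ¬nb = ⁅ k ⁆ ∪ T , insert-independent indT ¬nb , q⊆p∪q ⁅ k ⁆ T ∘ S⊆T
                 , inj₁ (x∈p∪q⁺ (inj₁ (x∈⁅x⁆ k))) ∷ All.map (dominates-mono (q⊆p∪q ⁅ k ⁆ T)) dom

  independent⇒⊆MIS : ∀ {S} → Independent G S → ∃ λ T → IsMIS G T × S ⊆ T
  independent⇒⊆MIS ind with extend-dominating (allFin n) ind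
  ... | T , indT , S⊆T , dom =
    T , Equivalence.from IsMIS⇔independent×dominating (indT , λ y → All.lookup dom (∈-allFin y))
      , S⊆T

module _ {n} (G : Graph n) where

  neighbours : Fin n → List (Fin n)
  neighbours v = filter (Adj? G v) (allFin n)

  degree≡length-neighbours : ∀ v → degree G v ≡ length (neighbours v)
  degree≡length-neighbours v = count-if≡length-filter (adj G v) (allFin n)

  ∈-neighbours⁺ : ∀ {v u} → Adj G v u → u ∈ₗ neighbours v
  ∈-neighbours⁺ {v} {u} vu = ∈-filter⁺ (Adj? G v) (∈-allFin u) vu

  ∈-neighbours⁻ : ∀ {v u} → u ∈ₗ neighbours v → Adj G v u
  ∈-neighbours⁻ {v} u∈ = proj₂ (∈-filter⁻ (Adj? G v) {xs = allFin n} u∈)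

  pendant-neighbour-unique : ∀ {p a b} → Pendant G p → Adj G p a → Adj G p b → a ≡ b
  pendant-neighbour-unique {p} pendant pa pb =
    length≡1⇒≡ (≡.trans (≡.sym (degree≡length-neighbours p)) pendant)
               (∈-neighbours⁺ pa) (∈-neighbours⁺ pb)

  other-neighbour : ∀ {w v} → ¬ Pendant G w → Adj G w v → ∃ λ z → Adj G w z × z ≢ v
  other-neighbour {w} ¬pendant wv
    with other-member _≟_ (filter⁺ (Adj? G w) (allFin⁺ n)) (∈-neighbours⁺ wv)
                          (¬pendant ∘ ≡.trans (degree≡length-neighbours w))
  ... | z , z∈ , z≢v = z , ∈-neighbours⁻ z∈ , z≢v

-- Paths and cycles

module _ {n} (G : Graph n) where

  path-∷ʳ : ∀ {u l w} → Path G (u ∷ l) → Adj G (last u l) w → Path G ((u ∷ l) ∷ʳ w)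
  path-∷ʳ (single u)        e  = cons u _ [] e (single _)
  path-∷ʳ (cons u v l uv p) e′ = cons u v (l ∷ʳ _) uv (path-∷ʳ p e′)

  rotate-cycle : ∀ {v vs} → IsCycle G (v ∷ vs) → IsCycle G (vs ∷ʳ v)
  rotate-cycle {v} {[]} (s≤s () , _)
  rotate-cycle {v} {w ∷ ws} (len , v∉ ∷ uniq , cons _ _ _ vw p , close) =
      subst (3 ≤_) (≡.sym (cong ℕ.suc (length-∷ʳ ws v))) len
    , ++⁺ uniq ([] ∷ []) (λ { (v∈ , here refl) → All.lookup v∉ v∈ refl ; (_ , there ()) })
    , path-∷ʳ p close
    , subst (λ z → Adj G z w) (≡.sym (last-∷ʳ w ws v)) vw

  rotate-to-front : ∀ L {x M} → IsCycle G (L ++ x ∷ M) → ∃ λ l → IsCycle G (x ∷ l)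
  rotate-to-front []      cycle = _ , cycle
  rotate-to-front (v ∷ L) {x} {M} cycle =
    rotate-to-front L {x} {M ∷ʳ v}
      (subst (IsCycle G) (++-assoc L (x ∷ M) (v ∷ [])) (rotate-cycle cycle))

  path⇒reach∖ : ∀ {x u l} → Path G (u ∷ l) → All (x ≢_) (u ∷ l) → Reach (G ∖ x) u (last u l)
  path⇒reach∖ (single u) _ = here
  path⇒reach∖ {x} (cons u w l uw p) (x≢u ∷ x≢w∷l@(x≢w ∷ _)) =
    step (Adj-∖⁺ G x uw (≢-sym x≢u) (≢-sym x≢w)) (path⇒reach∖ p x≢w∷l)

  cycle-neighbours : ∀ {x} → OnCycle G x →
    ∃₂ λ a a′ → a ≢ a′ × Adj G x a × Adj G x a′ × Reach (G ∖ x) a a′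
  cycle-neighbours (c , cycle , x∈c) with ∈-∃++ x∈c
  ... | L , M , refl with rotate-to-front L cycle
  ...   | []    , (s≤s () , _)
  ...   | _ ∷ [] , (s≤s (s≤s ()) , _)
  ...   | a ∷ b ∷ l , (_ , (x∉ ∷ a∉ ∷ _) , cons _ _ _ xa p , close) =
    a , last b l , All.lookup a∉ (last-∈ b l) , xa , Adj-sym G close , path⇒reach∖ p x∉

module _ {n} (G : Graph n) where

  open DecMembership (_≟_ {n}) using () renaming (_∈?_ to _∈ₗ?_)

  SimplePath : Fin n → Fin n → Set
  SimplePath u w = ∃ λ l → Unique (u ∷ l) × Path G (u ∷ l) × last u l ≡ w

  simplePath-suffix : ∀ {u x l w} → u ∈ₗ x ∷ l → Unique (x ∷ l) → Path G (x ∷ l) → last x l ≡ w →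
                      SimplePath u w
  simplePath-suffix (here refl) uniq p end = _ , uniq , p , end
  simplePath-suffix {l = _ ∷ _} (there u∈) (_ ∷ uniq) (cons _ _ _ _ p) end =
    simplePath-suffix u∈ uniq p end

  reach⇒simplePath : ∀ {u w} → Reach G u w → SimplePath u w
  reach⇒simplePath here = [] , [] ∷ [] , single _ , refl
  reach⇒simplePath (step {u} {x} ux r) with reach⇒simplePath r
  ... | l , uniq , p , end with u ∈ₗ? (x ∷ l)
  ...   | yes u∈ = simplePath-suffix u∈ uniq p end
  ...   | no u∉  = x ∷ l , ¬Any⇒All¬ _ u∉ ∷ uniq , cons u x l ux p , end

module _ {n} {H G : Graph n} (H⊆G : SpanningSubgraph H G) where

  bypass⇒onCycle : ∀ {y s} → Adj G y s → ¬ Adj H y s → Reach H y s → OnCycle G y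
  bypass⇒onCycle {y} ys ¬ys r with reach⇒simplePath H r
  ... | []     , _ , _ , refl = ⊥-elim (Adj-irrefl G ys)
  ... | _ ∷ [] , _ , cons _ _ _ ys′ _ , refl = ⊥-elim (¬ys ys′)
  ... | a ∷ b ∷ l , uniq , p , end =
    y ∷ a ∷ b ∷ l , (s≤s (s≤s (s≤s ℕ.z≤n)) , uniq , path-mono H⊆G p
                   , subst (λ z → Adj G z y) (≡.sym end) (Adj-sym G ys)) , here refl

-- Sufficiency

module _ {n} (G : Graph n) {S : Subset n} (mis : IsMIS G S) where

  robust-if-dominated : (∀ {H} → SpanningSubgraph H G → Connected H →
                           ∀ {y} → y ∉ S → ∃ λ s → s ∈ S × Adj H y s) →
                        Robust G S
  robust-if-dominated dominated H H⊆G H-connected =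
    Equivalence.from (IsMIS⇔independent×dominating H)
                     (independent-mono {H = H} {G = G} H⊆G (proj₁ mis) , dominates)
    where
    dominates : ∀ y → Dominates H S y
    dominates y with y ∈? S
    ... | yes y∈S = inj₁ y∈S
    ... | no y∉S  = inj₂ (dominated H⊆G H-connected y∉S)

  completeBipartite⇒robust : CompleteBipartite G → Robust G S
  completeBipartite⇒robust (side , bipartite) = robust-if-dominated dominated
    where
    opposite : ∀ {u w} → Adj G u w → side u ≢ side w
    opposite {u} {w} = Equivalence.to (bipartite u w)

    same-side : ∀ {y s w} → Adj G y s → Adj G y w → side s ≡ side w
    same-side ys yw = ≡.trans (¬-not (≢-sym (opposite ys))) (≡.sym (¬-not (≢-sym (opposite yw))))

    -- s and w lie opposite y, so an MIS-neighbour of w would be adjacent to s.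
    neighbours-in-S : ∀ {y s w} → y ∉ S → s ∈ S → Adj G y s → Adj G y w → w ∈ S
    neighbours-in-S {s = s} {w} y∉S s∈S ys yw with w ∈? S
    ... | yes w∈S = w∈S
    ... | no w∉S with MIS-neighbour G mis w∉S
    ...   | t , t∈S , wt = ⊥-elim (proj₁ mis s t s∈S t∈S
                  (Equivalence.from (bipartite s t) (opposite wt ∘ ≡.trans (≡.sym (same-side ys yw)))))

    dominated : ∀ {H} → SpanningSubgraph H G → Connected H → ∀ {y} → y ∉ S → ∃ λ s → s ∈ S × Adj H y s
    dominated {H} H⊆G H-connected {y} y∉S with MIS-neighbour G mis y∉S
    ... | s , s∈S , ys with reach⇒neighbour H (Adj⇒≢ G ys) (H-connected y s)
    ...   | w , yw = w , neighbours-in-S y∉S s∈S ys (H⊆G y w yw) , yw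

  pendant-in-MIS : ∀ {p y} → Pendant G p → Adj G p y → y ∉ S → p ∈ S
  pendant-in-MIS {p} pendant py y∉S with p ∈? S
  ... | yes p∈S = p∈S
  ... | no p∉S with MIS-neighbour G mis p∉S
  ...   | t , t∈S , pt with refl ← pendant-neighbour-unique G pendant py pt = ⊥-elim (y∉S t∈S)

  sputnik⇒robust : Sputnik G → Robust G S
  sputnik⇒robust sputnik = robust-if-dominated dominated
    where
    dominated : ∀ {H} → SpanningSubgraph H G → Connected H → ∀ {y} → y ∉ S → ∃ λ s → s ∈ S × Adj H y s
    dominated {H} H⊆G H-connected {y} y∉S with neighbour-in? H S y
    ... | yes nb  = nb
    ... | no ¬nb with MIS-neighbour G mis y∉S
    ...   | s , s∈S , ys
      with sputnik y (bypass⇒onCycle H⊆G ys (λ ys′ → ¬nb (s , s∈S , ys′)) (H-connected y s))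
    ...     | p , yp , pendant = p , pendant-in-MIS pendant (Adj-sym G yp) y∉S , Adj-sym H py
      where
      py : Adj H p y
      py with reach⇒neighbour H (≢-sym (Adj⇒≢ G yp)) (H-connected p y)
      ... | w , pw with refl ← pendant-neighbour-unique G pendant (Adj-sym G yp) (H⊆G p w pw) = pw

-- Necessity

CompleteBipartition : ∀ {n} → Graph n → (Fin n → Bool) → Set
CompleteBipartition {n} G side = ∀ (u w : Fin n) → Adj G u w ⇔ (side u ≢ side w)

completeBipartition? : ∀ {n} (G : Graph n) side → Dec (CompleteBipartition G side)
completeBipartition? G side = all? λ u → all? λ w → Adj? G u w ⇔? ¬? (side u ≟ᵇ side w)

module _ {n} {G : Graph n} (connected : Connected G) {a x : Fin n} (ax : Adj G a x)
         (twin-of-x : ∀ {z} → Adj G a z → ∀ y → Adj G z y ⇔ Adj G x y)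
         (twin-of-a : ∀ {y} → Adj G x y → ∀ t → Adj G y t ⇔ Adj G a t) where

  neighbour-of-a-or-x : ∀ u → Adj G a u ⊎ Adj G x u
  neighbour-of-a-or-x u = walk (inj₁ ax) (connected x u)
    where
    walk : ∀ {v w} → Adj G a v ⊎ Adj G x v → Reach G v w → Adj G a w ⊎ Adj G x w
    walk side here = side
    walk (inj₁ av) (step vw r) = walk (inj₂ (Equivalence.to (twin-of-x av _) vw)) r
    walk (inj₂ xv) (step vw r) = walk (inj₁ (Equivalence.to (twin-of-a xv _) vw)) r

  not-neighbour-of-both : ∀ {u} → Adj G a u → Adj G x u → ⊥
  not-neighbour-of-both au xu = Adj-irrefl G (Equivalence.from (twin-of-a xu _) au)

  non-neighbour-of-a : ∀ {u} → Adj G x u → adj G a u ≡ false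
  non-neighbour-of-a xu = ¬-not λ au → not-neighbour-of-both au xu

  twins⇒completeBipartition : CompleteBipartition G (adj G a)
  twins⇒completeBipartition u w = mk⇔ to from
    where
    to : Adj G u w → adj G a u ≢ adj G a w
    to uw same with neighbour-of-a-or-x u
    ... | inj₁ au = not-neighbour-of-both (≡.trans (≡.sym same) au) (Equivalence.to (twin-of-x au w) uw)
    ... | inj₂ xu = not-neighbour-of-both (≡.trans same (Equivalence.to (twin-of-a xu w) uw)) xu
    from : adj G a u ≢ adj G a w → Adj G u w
    from differ with neighbour-of-a-or-x u | neighbour-of-a-or-x w
    ... | inj₁ au | inj₁ aw = ⊥-elim (differ (≡.trans au (≡.sym aw)))
    ... | inj₁ au | inj₂ xw = Adj-sym G (Equivalence.from (twin-of-a xw u) au)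
    ... | inj₂ xu | inj₁ aw = Equivalence.from (twin-of-a xu w) aw
    ... | inj₂ xu | inj₂ xw =
      ⊥-elim (differ (≡.trans (non-neighbour-of-a xu) (≡.sym (non-neighbour-of-a xw))))

module Necessity {n} {G : Graph n} (connected : Connected G)
                 (all-robust : ∀ S → IsMIS G S → Robust G S) where

  module NoSeparation
    (v : Fin n) (leafless : ∀ w → Adj G v w → ∃ λ z → Adj G w z × z ≢ v)
    (_⇝?_ : ∀ u w → Dec (Reach (G ∖ v) u w))
    {p q c : Fin n} (vp : Adj G v p) (vq : Adj G v q) (cq : Adj G c q) (¬pc : ¬ Adj G p c) (c≢v : c ≢ v)
    (p⇝q : Reach (G ∖ v) p q) (c⇝q : Reach (G ∖ v) c q) where

    _⇝_ : Fin n → Fin n → Set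
    u ⇝ w = Reach (G ∖ v) u w

    ⇝-trans : ∀ {u w z} → u ⇝ w → w ⇝ z → u ⇝ z
    ⇝-trans = reach-trans (G ∖ v)

    ⇝-sym : ∀ {u w} → u ⇝ w → w ⇝ u
    ⇝-sym = reach-sym (G ∖ v)

    partner : Fin n → Fin n
    partner w with Adj? G v w
    ... | yes vw = proj₁ (leafless w vw)
    ... | no _   = w

    partner-spec : ∀ {w} → Adj G v w → Adj G w (partner w) × partner w ≢ v
    partner-spec {w} vw with Adj? G v w
    ... | yes vw′ = proj₂ (leafless w vw′)
    ... | no ¬vw  = ⊥-elim (¬vw vw)

    partner⇝ : ∀ {w} → Adj G v w → w ⇝ partner w
    partner⇝ vw = edge-∖ G v (proj₁ (partner-spec vw)) (Adj⇒≢ G (Adj-sym G vw))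
                             (proj₂ (partner-spec vw))

    -- w is the least neighbour of v in its component of G ∖ v, a component other than that of p.
    Leader : Fin n → Set
    Leader w = Adj G v w × ¬ w ⇝ p × (∀ w′ → w′ < w → Adj G v w′ → ¬ w′ ⇝ w)

    leader? : ∀ w → Dec (Leader w)
    leader? w = Adj? G v w ×-dec ¬? (w ⇝? p)
                ×-dec all? λ w′ → (w′ <? w) →-dec Adj? G v w′ →-dec ¬? (w′ ⇝? w)

    leaders-separated : ∀ {w w′} → Leader w → Leader w′ → w ⇝ w′ → w ≡ w′
    leaders-separated {w} {w′} (vw , _ , least) (vw′ , _ , least′) w⇝w′ with <-cmp w w′
    ... | tri< w<w′ _ _ = ⊥-elim (least′ w w<w′ vw w⇝w′)
    ... | tri≈ _ w≡w′ _ = w≡w′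
    ... | tri> _ _ w′<w = ⊥-elim (least w′ w′<w vw′ (⇝-sym w⇝w′))

    -- Taking a partner of every leader into S keeps all leaders out of S; with q ∉ S this
    -- keeps every component of G ∖ v attached to v after the edges from v into S are cut.
    Seed : Fin n → Set
    Seed y = y ≡ p ⊎ y ≡ c ⊎ ∃ λ w → Leader w × partner w ≡ y

    seed? : ∀ y → Dec (Seed y)
    seed? y = (y ≟ p) ⊎-dec (y ≟ c) ⊎-dec any? λ w → leader? w ×-dec (partner w ≟ y)

    partner-adjacent⇒⇝ : ∀ {w y} → Leader w → Adj G (partner w) y → y ≢ v → w ⇝ y
    partner-adjacent⇒⇝ (vw , _) zy y≢v =
      ⇝-trans (partner⇝ vw) (edge-∖ G v zy (proj₂ (partner-spec vw)) y≢v)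

    ¬partner-p : ∀ {w} → Leader w → ¬ Adj G (partner w) p
    ¬partner-p L@(_ , ¬w⇝p , _) zp = ¬w⇝p (partner-adjacent⇒⇝ L zp (Adj⇒≢ G (Adj-sym G vp)))

    ¬partner-c : ∀ {w} → Leader w → ¬ Adj G (partner w) c
    ¬partner-c L@(_ , ¬w⇝p , _) zc =
      ¬w⇝p (⇝-trans (partner-adjacent⇒⇝ L zc c≢v) (⇝-trans c⇝q (⇝-sym p⇝q)))

    ¬partner-partner : ∀ {w w′} → Leader w → Leader w′ → ¬ Adj G (partner w) (partner w′)
    ¬partner-partner L L′@(vw′ , _) zz′ with refl ← leaders-separated L L′
      (⇝-trans (partner-adjacent⇒⇝ L zz′ (proj₂ (partner-spec vw′))) (⇝-sym (partner⇝ vw′))) =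
      Adj-irrefl G zz′

    seeds-nonadjacent : ∀ {u w} → Seed u → Seed w → ¬ Adj G u w
    seeds-nonadjacent (inj₁ refl)               (inj₁ refl)               = Adj-irrefl G
    seeds-nonadjacent (inj₁ refl)               (inj₂ (inj₁ refl))        = ¬pc
    seeds-nonadjacent (inj₁ refl)               (inj₂ (inj₂ (_ , L , refl))) = ¬partner-p L ∘ Adj-sym G
    seeds-nonadjacent (inj₂ (inj₁ refl))        (inj₁ refl)               = ¬pc ∘ Adj-sym G
    seeds-nonadjacent (inj₂ (inj₁ refl))        (inj₂ (inj₁ refl))        = Adj-irrefl G
    seeds-nonadjacent (inj₂ (inj₁ refl))        (inj₂ (inj₂ (_ , L , refl))) = ¬partner-c L ∘ Adj-sym G
    seeds-nonadjacent (inj₂ (inj₂ (_ , L , refl))) (inj₁ refl)            = ¬partner-p L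
    seeds-nonadjacent (inj₂ (inj₂ (_ , L , refl))) (inj₂ (inj₁ refl))     = ¬partner-c L
    seeds-nonadjacent (inj₂ (inj₂ (_ , L , refl))) (inj₂ (inj₂ (_ , L′ , refl))) = ¬partner-partner L L′

    seed-independent : Independent G (subset seed?)
    seed-independent u w u∈ w∈ = seeds-nonadjacent (∈-subset⁻ seed? u∈) (∈-subset⁻ seed? w∈)

    S : Subset n
    S = proj₁ (independent⇒⊆MIS G seed-independent)

    S-MIS : IsMIS G S
    S-MIS = proj₁ (proj₂ (independent⇒⊆MIS G seed-independent))

    seed⊆S : ∀ {y} → Seed y → y ∈ S
    seed⊆S = proj₂ (proj₂ (independent⇒⊆MIS G seed-independent)) ∘ ∈-subset⁺ seed?

    v∉S : v ∉ S
    v∉S v∈S = proj₁ S-MIS v p v∈S (seed⊆S (inj₁ refl)) vp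

    q∉S : q ∉ S
    q∉S q∈S = proj₁ S-MIS c q (seed⊆S (inj₂ (inj₁ refl))) q∈S cq

    leader∉S : ∀ {w} → Leader w → w ∉ S
    leader∉S {w} L@(vw , _) w∈S =
      proj₁ S-MIS w (partner w) w∈S (seed⊆S (inj₂ (inj₂ (w , L , refl)))) (proj₁ (partner-spec vw))

    escape : ∀ {u} → Adj G v u → ∃ λ w → Adj G v w × w ∉ S × u ⇝ w
    escape {u} vu with u ⇝? p
    ... | yes u⇝p = q , vq , q∉S , ⇝-trans u⇝p p⇝q
    ... | no ¬u⇝p with minimal (λ w → Adj? G v w ×-dec (w ⇝? u)) (vu , here)
    ...   | w , (vw , w⇝u) , below = w , vw , leader∉S leader , ⇝-sym w⇝u
      where
      leader : Leader w
      leader = vw , (λ w⇝p → ¬u⇝p (⇝-trans (⇝-sym w⇝u) w⇝p))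
                  , λ w′ w′<w vw′ w′⇝w → below w′ w′<w (vw′ , ⇝-trans w′⇝w w⇝u)

    Cut : Fin n → Fin n → Set
    Cut u w = (u ≡ v × w ∈ S) ⊎ (w ≡ v × u ∈ S)

    cut? : ∀ u w → Dec (Cut u w)
    cut? u w = ((u ≟ v) ×-dec (w ∈? S)) ⊎-dec ((w ≟ v) ×-dec (u ∈? S))

    module H = RemoveEdges G cut? Sum.swap

    ∖v⊆H : SpanningSubgraph (G ∖ v) H.graph
    ∖v⊆H u w uw = H.keeps (∖-⊆ G v u w uw)
      [ (λ { (u≡v , _) → proj₁ (Adj-∖⁻ G v uw) u≡v }) , (λ { (w≡v , _) → proj₂ (Adj-∖⁻ G v uw) w≡v }) ]

    reach-v-in-H : ∀ {u} → Adj G v u → Reach H.graph u v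
    reach-v-in-H vu with escape vu
    ... | w , vw , w∉S , u⇝w = reach-trans H.graph (reach-mono ∖v⊆H u⇝w) (step wv here)
      where
      wv : Adj H.graph w v
      wv = H.keeps (Adj-sym G vw) [ (λ { (w≡v , _) → Adj⇒≢ G (Adj-sym G vw) w≡v }) , (λ { (_ , w∈S) → w∉S w∈S }) ]

    toward-v : ∀ {y} → Reach G y v → Reach H.graph y v
    toward-v here = here
    toward-v (step {y} {y₁} yy₁ r) with y ≟ v | y₁ ≟ v
    ... | yes refl | _        = here
    ... | no _     | yes refl = reach-v-in-H (Adj-sym G yy₁)
    ... | no y≢v   | no y₁≢v  = step (∖v⊆H y y₁ (Adj-∖⁺ G v yy₁ y≢v y₁≢v)) (toward-v r)

    H-connected : Connected H.graph
    H-connected u w =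
      reach-trans H.graph (toward-v (connected u v)) (reach-sym H.graph (toward-v (connected w v)))

    -- S is maximal in H, yet v has lost all its edges into S.
    impossible : ⊥
    impossible with proj₂ (Equivalence.to (IsMIS⇔independent×dominating H.graph)
                                          (all-robust S S-MIS H.graph H.⊆-original H-connected)) v
    ... | inj₁ v∈S              = v∉S v∈S
    ... | inj₂ (s , s∈S , vs) = H.drops (inj₁ (refl , s∈S)) vs

  module _ (v : Fin n) (leafless : ∀ w → Adj G v w → ∃ λ z → Adj G w z × z ≢ v) where

    no-separation : ∀ {p q c} → Adj G v p → Adj G v q → Adj G c q → ¬ Adj G p c → c ≢ v →
                    Reach (G ∖ v) p q → Reach (G ∖ v) c q → ⊥
    -- The goal is ⊥, so decidability of reachability in G ∖ v may be assumed classically.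
    no-separation vp vq cq ¬pc c≢v p⇝q c⇝q =
      ¬¬-decidable₂ λ _⇝?_ → NoSeparation.impossible v leafless _⇝?_ vp vq cq ¬pc c≢v p⇝q c⇝q

    connected-neighbours-⊆ : ∀ {p q} → Adj G v p → Adj G v q → Reach (G ∖ v) p q →
                             ∀ y → Adj G q y → Adj G p y
    connected-neighbours-⊆ {p} vp vq p⇝q y qy with Adj? G p y | y ≟ v
    ... | yes py | _        = py
    ... | no ¬py | yes refl = ⊥-elim (¬py (Adj-sym G vp))
    ... | no ¬py | no y≢v   = ⊥-elim (no-separation vp vq (Adj-sym G qy) ¬py y≢v p⇝q
                                (edge-∖ G v (Adj-sym G qy) y≢v (Adj⇒≢ G (Adj-sym G vq))))

    same-neighbours : ∀ {p q} → Adj G v p → Adj G v q → Reach (G ∖ v) p q →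
                      ∀ y → Adj G p y ⇔ Adj G q y
    same-neighbours vp vq p⇝q y =
      mk⇔ (connected-neighbours-⊆ vq vp (reach-sym (G ∖ v) p⇝q) y) (connected-neighbours-⊆ vp vq p⇝q y)

  pendant-free-cycle⇒completeBipartition : ∀ {x} → OnCycle G x → (∀ u → Adj G x u → ¬ Pendant G u) →
                                           ∃ λ a → CompleteBipartition G (adj G a)
  pendant-free-cycle⇒completeBipartition {x} x-on-cycle no-pendant
    with cycle-neighbours G x-on-cycle
  ... | a , a′ , a≢a′ , xa , xa′ , a⇝a′ with other-neighbour G (no-pendant a xa) (Adj-sym G xa)
  ...   | b , ab , b≢x = a , twins⇒completeBipartition connected (Adj-sym G xa) twin-of-x twin-of-a
    where
    leafless-x : ∀ w → Adj G x w → ∃ λ z → Adj G w z × z ≢ x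
    leafless-x w xw = other-neighbour G (no-pendant w xw) (Adj-sym G xw)

    a≈a′ : ∀ y → Adj G a y ⇔ Adj G a′ y
    a≈a′ = same-neighbours x leafless-x xa xa′ a⇝a′

    leafless-a : ∀ w → Adj G a w → ∃ λ z → Adj G w z × z ≢ a
    leafless-a w aw = a′ , Adj-sym G (Equivalence.to (a≈a′ w) aw) , ≢-sym a≢a′

    twin-of-x : ∀ {z} → Adj G a z → ∀ y → Adj G z y ⇔ Adj G x y
    twin-of-x {z} az = same-neighbours a leafless-a az (Adj-sym G xa) z⇝x
      where
      z⇝x : Reach (G ∖ a) z x
      z⇝x = reach-trans (G ∖ a)
              (edge-∖ G a (Adj-sym G (Equivalence.to (a≈a′ z) az)) (Adj⇒≢ G (Adj-sym G az)) (≢-sym a≢a′))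
              (edge-∖ G a (Adj-sym G xa′) (≢-sym a≢a′) (Adj⇒≢ G xa))

    twin-of-a : ∀ {y} → Adj G x y → ∀ t → Adj G y t ⇔ Adj G a t
    twin-of-a {y} xy = same-neighbours x leafless-x xy xa y⇝a
      where
      y⇝a : Reach (G ∖ x) y a
      y⇝a = reach-trans (G ∖ x)
              (edge-∖ G x (Adj-sym G (Equivalence.from (twin-of-x ab y) xy)) (Adj⇒≢ G (Adj-sym G xy)) b≢x)
              (edge-∖ G x (Adj-sym G ab) b≢x (Adj⇒≢ G (Adj-sym G xa)))

theorem1 : ∀ (n : ℕ) (G : Graph n) → Connected G →
    ((∀ (S : Subset n) → IsMIS G S → Robust G S) ⇔ (CompleteBipartite G ⊎ Sputnik G))
theorem1 n G connected = mk⇔ necessary sufficient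
  where
  sufficient : CompleteBipartite G ⊎ Sputnik G → ∀ S → IsMIS G S → Robust G S
  sufficient (inj₁ bipartite) S mis = completeBipartite⇒robust G mis bipartite
  sufficient (inj₂ sputnik)   S mis = sputnik⇒robust G mis sputnik

  necessary : (∀ S → IsMIS G S → Robust G S) → CompleteBipartite G ⊎ Sputnik G
  necessary all-robust with any? (λ a → completeBipartition? G (adj G a))
  ... | yes (a , bipartition) = inj₁ (adj G a , bipartition)
  ... | no ¬bipartition = inj₂ λ x x-on-cycle →
    decidable-stable (any? λ u → Adj? G x u ×-dec (degree G u ℕ.≟ 1)) λ no-pendant →
      ¬bipartition (Necessity.pendant-free-cycle⇒completeBipartition connected all-robust x-on-cycle
                      λ u xu pendant → no-pendant (u , xu , pendant))
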